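{- Let $\mathcal{F}$ be the union of $\{\epsilon,F\}$ with the set of Łukasiewicz paths that contain at most one up step (i.e. at most one step $U_k$ with $k\geq1$) and in which every flat step $F$ belongs to an occurrence of the pattern $FF$. For every $n\geq0$, there is a bijection between the set of paths of length $n$ in $\mathcal{F}$ and the set of $FF$-equivalence classes of the set $\mathcal{L}_n$ of Łukasiewicz paths of length $n$.
   Context: A Łukasiewicz path of length $n$ is a sequence of $n$ steps from $\{(1,i): i\geq -1\}$ starting at $(0,0)$, ending at $(n,0)$ and never going below the $x$-axis; $\epsilon$ is the empty path. Write $D=(1,-1)$, $F=(1,0)$, $U_k=(1,k)$ for $k\geq1$. Steps are numbered $1,\dots,n$; an occurrence of $FF$ (two consecutive flat steps) is at position $i$ if its first step is the $i$-th step. Two Łukasiewicz paths of the same length are $FF$-equivalent if the sets of occurrence positions of $FF$ in them are identical. -}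

module Defs where

open import Data.Nat using (ℕ; zero; suc; _+_; _∸_; _≤_)
open import Data.List using (List; []; _∷_; length)
open import Data.Maybe using (Maybe; just; nothing)
open import Data.Product using (Σ; _×_; _,_; proj₁; proj₂)
open import Data.Sum using (_⊎_)
open import Data.Empty using (⊥)
open import Function using (id; _∘_)
open import Function.Bundles using (_⇔_; mk⇔; Equivalence)
open import Relation.Binary.Bundles using (Setoid)
open import Relation.Binary.PropositionalEquality using (_≡_; setoid)
import Relation.Binary.Construct.On as On

-- Steps of a Łukasiewicz path:  D = (1,-1),  F = (1,0),  U k = (1, k+1)
-- (so  U 0  is U_1,  U 1  is U_2, ...).
data Step : Set where
  D : Step
  F : Step
  U : ℕ → Step

ValidFrom : ℕ → List Step → Set
ValidFrom h [] = h ≡ 0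
ValidFrom zero (D ∷ s) = ⊥
ValidFrom (suc h) (D ∷ s) = ValidFrom h s
ValidFrom h (F ∷ s) = ValidFrom h s
ValidFrom h (U k ∷ s) = ValidFrom (h + suc k) s

Luk : List Step → Set
Luk p = ValidFrom 0 p

-- the i-th step (steps numbered 1..n); nothing if out of range
stepAt : List Step → ℕ → Maybe Step
stepAt [] i = nothing
stepAt (x ∷ p) zero = nothing
stepAt (x ∷ p) (suc zero) = just x
stepAt (x ∷ p) (suc (suc i)) = stepAt p (suc i)

FFAt : List Step → ℕ → Set
FFAt p i = (stepAt p i ≡ just F) × (stepAt p (suc i) ≡ just F)

FFEquiv : List Step → List Step → Set
FFEquiv p q = ∀ i → FFAt p i ⇔ FFAt q i

upCount : List Step → ℕ
upCount [] = 0
upCount (U k ∷ p) = suc (upCount p)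
upCount (D ∷ p) = upCount p
upCount (F ∷ p) = upCount p

-- every flat step belongs to an occurrence of FF
-- (position 0 never carries an FF, so i ∸ 1 = 0 is harmless for i = 1)
EveryFInFF : List Step → Set
EveryFInFF p = ∀ i → stepAt p i ≡ just F → FFAt p i ⊎ FFAt p (i ∸ 1)

InFam : List Step → Set
InFam p = (p ≡ []) ⊎ (p ≡ F ∷ []) ⊎ (Luk p × upCount p ≤ 1 × EveryFInFF p)

FamSetoid : ℕ → Setoid _ _
FamSetoid n = On.setoid (setoid (List Step))
  (proj₁ {B = λ p → length p ≡ n × InFam p})

LukN : ℕ → Set
LukN n = Σ (List Step) (λ p → length p ≡ n × Luk p)

FFSetoid : ℕ → Setoid _ _
FFSetoid n = record
  { Carrier = LukN n
  ; _≈_ = λ p q → FFEquiv (proj₁ p) (proj₁ q)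
  ; isEquivalence = record
    { refl = λ i → mk⇔ id id
    ; sym = λ e i → mk⇔ (Equivalence.from (e i)) (Equivalence.to (e i))
    ; trans = λ e f i → mk⇔ (Equivalence.to (f i) ∘ Equivalence.to (e i))
                            (Equivalence.from (e i) ∘ Equivalence.from (f i))
    }
  }

-- The FF-class of a path of length n is determined by its FF occurrences, hence by the set of
-- positions covered by an occurrence.  A path of 𝓕 is flat exactly at its covered positions, and a
-- Łukasiewicz path with at most one up step is determined by its flat positions: if m positions are
-- not flat, the first carries U_(m−1) and the others D.  So every class has exactly one such
-- representativeative, obtained by flattening the covered positions and filling the m others this way;
-- m = 1 happens only for the class of F, which is why F is added to 𝓕.
module Submission where

open import Defs
open import Data.Bool using (Bool; true; false; T; _∧_; _∨_)
open import Data.Bool.Properties using (T-∧; T-∨; ∧-zeroʳ)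
open import Data.Empty using (⊥-elim)
open import Data.List using (List; []; _∷_; length; map)
open import Data.List.Properties using (length-map)
open import Data.Maybe using (just)
open import Data.Nat using (ℕ; zero; suc; _∸_; _≤_; z≤n; s≤s)
open import Data.Nat.Properties using (suc-injective; ≤-trans; n≤1+n; ≤∧≢⇒<; n<1⇒n≡0; n≤0⇒n≡0; _≟_)
open import Data.Product using (Σ; _×_; _,_; proj₁; proj₂)
open import Data.Sum using (_⊎_; inj₁; inj₂; swap)
open import Function using (id; const; _∘_)
open import Function.Bundles using (Bijection; _⇔_; mk⇔; Equivalence)
open import Relation.Nullary using (yes; no)
open import Relation.Binary.PropositionalEquality
  using (_≡_; _≢_; refl; sym; trans; cong; cong₂; subst; module ≡-Reasoning)

open Equivalence using (to; from)

-- Bit lists, read with the indexing of  stepAt : position 0 and positions past the end read false.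
bitAt : List Bool → ℕ → Bool
bitAt [] i = false
bitAt (b ∷ bs) zero = false
bitAt (b ∷ bs) (suc zero) = b
bitAt (b ∷ bs) (suc (suc i)) = bitAt bs (suc i)

bitAt-zero : ∀ bs → bitAt bs 0 ≡ false
bitAt-zero [] = refl
bitAt-zero (b ∷ bs) = refl

bitAt-false∷ : ∀ bs i → bitAt (false ∷ bs) i ≡ bitAt bs (i ∸ 1)
bitAt-false∷ bs zero = sym (bitAt-zero bs)
bitAt-false∷ bs (suc zero) = sym (bitAt-zero bs)
bitAt-false∷ bs (suc (suc i)) = refl

bitAt-extensional : ∀ {bs cs} → length bs ≡ length cs → (∀ i → bitAt bs i ≡ bitAt cs i) → bs ≡ cs
bitAt-extensional {[]} {[]} _ _ = refl
bitAt-extensional {b ∷ bs} {c ∷ cs} len eq = cong₂ _∷_ (eq 1) (bitAt-extensional (suc-injective len) tail)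
  where
  tail : ∀ i → bitAt bs i ≡ bitAt cs i
  tail zero = trans (bitAt-zero bs) (sym (bitAt-zero cs))
  tail (suc i) = eq (suc (suc i))

≡-fromT : ∀ {a b} → (T a → T b) → (T b → T a) → a ≡ b
≡-fromT {false} {false} _ _ = refl
≡-fromT {false} {true} _ b⇒a = ⊥-elim (b⇒a _)
≡-fromT {true} {false} a⇒b _ = ⊥-elim (a⇒b _)
≡-fromT {true} {true} _ _ = refl

pairs : List Bool → List Bool
pairs [] = []
pairs (a ∷ []) = false ∷ []
pairs (a ∷ b ∷ bs) = (a ∧ b) ∷ pairs (b ∷ bs)

length-pairs : ∀ bs → length (pairs bs) ≡ length bs
length-pairs [] = refl
length-pairs (a ∷ []) = refl
length-pairs (a ∷ b ∷ bs) = cong suc (length-pairs (b ∷ bs))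

bitAt-pairs : ∀ bs i → bitAt (pairs bs) i ≡ bitAt bs i ∧ bitAt bs (suc i)
bitAt-pairs [] i = refl
bitAt-pairs (a ∷ []) zero = refl
bitAt-pairs (a ∷ []) (suc zero) = sym (∧-zeroʳ a)
bitAt-pairs (a ∷ []) (suc (suc i)) = refl
bitAt-pairs (a ∷ b ∷ bs) zero = refl
bitAt-pairs (a ∷ b ∷ bs) (suc zero) = refl
bitAt-pairs (a ∷ b ∷ bs) (suc (suc i)) = bitAt-pairs (b ∷ bs) (suc i)

pairs-fst : ∀ bs i → T (bitAt (pairs bs) i) → T (bitAt bs i)
pairs-fst bs i t rewrite bitAt-pairs bs i = proj₁ (to T-∧ t)

pairs-snd : ∀ bs i → T (bitAt (pairs bs) i) → T (bitAt bs (suc i))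
pairs-snd bs i t rewrite bitAt-pairs bs i = proj₂ (to T-∧ t)

pairs-intro : ∀ bs i → T (bitAt bs i) → T (bitAt bs (suc i)) → T (bitAt (pairs bs) i)
pairs-intro bs i s t rewrite bitAt-pairs bs i = from T-∧ (s , t)

coverFrom : Bool → List Bool → List Bool
coverFrom b [] = []
coverFrom b (c ∷ cs) = (b ∨ c) ∷ coverFrom c cs

cover : List Bool → List Bool
cover = coverFrom false

length-coverFrom : ∀ b cs → length (coverFrom b cs) ≡ length cs
length-coverFrom b [] = refl
length-coverFrom b (c ∷ cs) = cong suc (length-coverFrom c cs)

-- Stated for lists of pairs only: for a list whose last bit is set, the identity fails one past its end.
bitAt-coverFrom-pairs : ∀ b a bs i →
  bitAt (coverFrom b (pairs (a ∷ bs))) i ≡ bitAt (b ∷ pairs (a ∷ bs)) i ∨ bitAt (pairs (a ∷ bs)) i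
bitAt-coverFrom-pairs b a [] zero = refl
bitAt-coverFrom-pairs b a [] (suc zero) = refl
bitAt-coverFrom-pairs b a [] (suc (suc zero)) = refl
bitAt-coverFrom-pairs b a [] (suc (suc (suc i))) = refl
bitAt-coverFrom-pairs b a (c ∷ cs) zero = refl
bitAt-coverFrom-pairs b a (c ∷ cs) (suc zero) = refl
bitAt-coverFrom-pairs b a (c ∷ cs) (suc (suc i)) = bitAt-coverFrom-pairs (a ∧ c) c cs (suc i)

bitAt-cover-pairs : ∀ bs i → bitAt (cover (pairs bs)) i ≡ bitAt (pairs bs) (i ∸ 1) ∨ bitAt (pairs bs) i
bitAt-cover-pairs [] i = refl
bitAt-cover-pairs (a ∷ bs) i =
  trans (bitAt-coverFrom-pairs false a bs i) (cong (_∨ bitAt (pairs (a ∷ bs)) i) (bitAt-false∷ (pairs (a ∷ bs)) i))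

T-cover-pairs : ∀ bs i → T (bitAt (cover (pairs bs)) i) ⇔ (T (bitAt (pairs bs) i) ⊎ T (bitAt (pairs bs) (i ∸ 1)))
T-cover-pairs bs i rewrite bitAt-cover-pairs bs i =
  mk⇔ (swap ∘ to T-∨) (from T-∨ ∘ swap)

cover-pairs-⊆ : ∀ bs i → T (bitAt (cover (pairs bs)) i) → T (bitAt bs i)
cover-pairs-⊆ bs i t with to (T-cover-pairs bs i) t
... | inj₁ pᵢ = pairs-fst bs i pᵢ
cover-pairs-⊆ bs zero t | inj₂ p₀ rewrite bitAt-zero (pairs bs) = ⊥-elim p₀
cover-pairs-⊆ bs (suc i) t | inj₂ pᵢ = pairs-snd bs i pᵢ

PairCovered : List Bool → Set
PairCovered bs = ∀ i → T (bitAt bs i) → T (bitAt (cover (pairs bs)) i)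

cover-pairs-≡ : ∀ bs → PairCovered bs → cover (pairs bs) ≡ bs
cover-pairs-≡ bs covered = bitAt-extensional
  (trans (length-coverFrom false (pairs bs)) (length-pairs bs))
  (λ i → ≡-fromT (cover-pairs-⊆ bs i) (covered i))

-- With Pⱼ = bⱼ ∧ bⱼ₊₁ this reads (Pᵢ₋₁ ∨ Pᵢ) ∧ (Pᵢ ∨ Pᵢ₊₁) ≡ Pᵢ.
pair-of-windows : ∀ w x y z → ((w ∧ x) ∨ (x ∧ y)) ∧ ((x ∧ y) ∨ (y ∧ z)) ≡ x ∧ y
pair-of-windows true false y z = refl
pair-of-windows false false y z = refl
pair-of-windows true true false z = refl
pair-of-windows false true false z = refl
pair-of-windows true true true z = refl
pair-of-windows false true true z = refl

pairs-cover-pairs : ∀ bs → pairs (cover (pairs bs)) ≡ pairs bs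
pairs-cover-pairs bs = bitAt-extensional
  (trans (length-pairs (cover (pairs bs))) (length-coverFrom false (pairs bs)))
  bitwise
  where
  cs = cover (pairs bs)
  bitwise : ∀ i → bitAt (pairs cs) i ≡ bitAt (pairs bs) i
  bitwise zero = trans (bitAt-zero (pairs cs)) (sym (bitAt-zero (pairs bs)))
  bitwise (suc i)
    rewrite bitAt-pairs cs (suc i) | bitAt-cover-pairs bs (suc i) | bitAt-cover-pairs bs (suc (suc i))
          | bitAt-pairs bs i | bitAt-pairs bs (suc i) | bitAt-pairs bs (suc (suc i))
    = pair-of-windows (bitAt bs i) (bitAt bs (suc i)) (bitAt bs (suc (suc i))) (bitAt bs (suc (suc (suc i))))

PairCovered-cover-pairs : ∀ bs → PairCovered (cover (pairs bs))
PairCovered-cover-pairs bs i t rewrite pairs-cover-pairs bs = t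

holes : List Bool → ℕ
holes [] = 0
holes (true ∷ bs) = holes bs
holes (false ∷ bs) = suc (holes bs)

holes-antitone : ∀ bs cs → length bs ≡ length cs → (∀ i → T (bitAt cs i) → T (bitAt bs i)) →
  holes bs ≤ holes cs
holes-antitone [] [] _ _ = z≤n
holes-antitone (b ∷ bs) (c ∷ cs) len cs⊆bs =
  cons b c (cs⊆bs 1) (holes-antitone bs cs (suc-injective len) tail)
  where
  tail : ∀ i → T (bitAt cs i) → T (bitAt bs i)
  tail zero t rewrite bitAt-zero cs = ⊥-elim t
  tail (suc i) = cs⊆bs (suc (suc i))
  cons : ∀ b c → (T c → T b) → holes bs ≤ holes cs → holes (b ∷ bs) ≤ holes (c ∷ cs)
  cons true true _ ih = ih
  cons true false _ ih = ≤-trans ih (n≤1+n (holes cs))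
  cons false true c⇒b _ = ⊥-elim (c⇒b _)
  cons false false _ ih = s≤s ih

isF : Step → Bool
isF D = false
isF F = true
isF (U k) = false

flats : List Step → List Bool
flats = map isF

stepAt-F : ∀ p i → stepAt p i ≡ just F ⇔ T (bitAt (flats p) i)
stepAt-F [] i = mk⇔ (λ ()) (λ ())
stepAt-F (x ∷ p) zero = mk⇔ (λ ()) (λ ())
stepAt-F (D ∷ p) (suc zero) = mk⇔ (λ ()) (λ ())
stepAt-F (F ∷ p) (suc zero) = mk⇔ _ (const refl)
stepAt-F (U k ∷ p) (suc zero) = mk⇔ (λ ()) (λ ())
stepAt-F (x ∷ p) (suc (suc i)) = stepAt-F p (suc i)

length-pairs-flats : ∀ p → length (pairs (flats p)) ≡ length p
length-pairs-flats p = trans (length-pairs (flats p)) (length-map isF p)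

FFAt-pairs : ∀ p i → FFAt p i ⇔ T (bitAt (pairs (flats p)) i)
FFAt-pairs p i = mk⇔
  (λ (fᵢ , fᵢ₊₁) → pairs-intro (flats p) i (to (stepAt-F p i) fᵢ) (to (stepAt-F p (suc i)) fᵢ₊₁))
  (λ t → from (stepAt-F p i) (pairs-fst (flats p) i t) , from (stepAt-F p (suc i)) (pairs-snd (flats p) i t))

FFEquiv-reflexive : ∀ {p q} → p ≡ q → FFEquiv p q
FFEquiv-reflexive refl i = mk⇔ id id

FFEquiv⇒pairs-≡ : ∀ p q → length p ≡ length q → FFEquiv p q → pairs (flats p) ≡ pairs (flats q)
FFEquiv⇒pairs-≡ p q len equiv = bitAt-extensional
  (trans (length-pairs-flats p) (trans len (sym (length-pairs-flats q))))
  (λ i → ≡-fromT (to (FFAt-pairs q i) ∘ to (equiv i) ∘ from (FFAt-pairs p i))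
                 (to (FFAt-pairs p i) ∘ from (equiv i) ∘ from (FFAt-pairs q i)))

pairs-≡⇒FFEquiv : ∀ p q → pairs (flats p) ≡ pairs (flats q) → FFEquiv p q
pairs-≡⇒FFEquiv p q eq i = mk⇔
  (from (FFAt-pairs q i) ∘ subst (λ bs → T (bitAt bs i)) eq ∘ to (FFAt-pairs p i))
  (from (FFAt-pairs p i) ∘ subst (λ bs → T (bitAt bs i)) (sym eq) ∘ to (FFAt-pairs q i))

EveryFInFF⇔PairCovered : ∀ p → EveryFInFF p ⇔ PairCovered (flats p)
EveryFInFF⇔PairCovered p = mk⇔
  (λ every i fᵢ → from (T-cover-pairs (flats p) i) (toBits i (every i (from (stepAt-F p i) fᵢ))))
  (λ covered i fᵢ → fromBits i (to (T-cover-pairs (flats p) i) (covered i (to (stepAt-F p i) fᵢ))))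
  where
  toBits : ∀ i → FFAt p i ⊎ FFAt p (i ∸ 1) →
    T (bitAt (pairs (flats p)) i) ⊎ T (bitAt (pairs (flats p)) (i ∸ 1))
  toBits i (inj₁ ff) = inj₁ (to (FFAt-pairs p i) ff)
  toBits i (inj₂ ff) = inj₂ (to (FFAt-pairs p (i ∸ 1)) ff)
  fromBits : ∀ i → T (bitAt (pairs (flats p)) i) ⊎ T (bitAt (pairs (flats p)) (i ∸ 1)) →
    FFAt p i ⊎ FFAt p (i ∸ 1)
  fromBits i (inj₁ t) = inj₁ (from (FFAt-pairs p i) t)
  fromBits i (inj₂ t) = inj₂ (from (FFAt-pairs p (i ∸ 1)) t)

downs : List Bool → List Step
downs [] = []
downs (true ∷ bs) = F ∷ downs bs
downs (false ∷ bs) = D ∷ downs bs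

upThenDowns : ℕ → List Bool → List Step
upThenDowns k [] = []
upThenDowns k (true ∷ bs) = F ∷ upThenDowns k bs
upThenDowns k (false ∷ bs) = U k ∷ downs bs

allFlat : List Bool → List Step
allFlat = map (const F)

-- With m ≥ 2 holes the holes carry U_(m−1) followed by m − 1 down steps (recall  U k  is U_(k+1));
-- with fewer holes no such path exists, and the all-flat choice turns the one-hole mask of F back into F.
realiseWith : ℕ → List Bool → List Step
realiseWith (suc (suc k)) bs = upThenDowns k bs
realiseWith m bs = allFlat bs

realise : List Bool → List Step
realise bs = realiseWith (holes bs) bs

flats-downs : ∀ bs → flats (downs bs) ≡ bs
flats-downs [] = refl
flats-downs (true ∷ bs) = cong (true ∷_) (flats-downs bs)
flats-downs (false ∷ bs) = cong (false ∷_) (flats-downs bs)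

flats-upThenDowns : ∀ k bs → flats (upThenDowns k bs) ≡ bs
flats-upThenDowns k [] = refl
flats-upThenDowns k (true ∷ bs) = cong (true ∷_) (flats-upThenDowns k bs)
flats-upThenDowns k (false ∷ bs) = cong (false ∷_) (flats-downs bs)

flats-allFlat : ∀ bs → holes bs ≡ 0 → flats (allFlat bs) ≡ bs
flats-allFlat [] _ = refl
flats-allFlat (true ∷ bs) h = cong (true ∷_) (flats-allFlat bs h)

flats-realise : ∀ bs → holes bs ≢ 1 → flats (realise bs) ≡ bs
flats-realise bs h≢1 with holes bs in h
... | zero = flats-allFlat bs h
... | suc zero = ⊥-elim (h≢1 refl)
... | suc (suc k) = flats-upThenDowns k bs

ValidFrom-F : ∀ h s → ValidFrom h s → ValidFrom h (F ∷ s)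
ValidFrom-F zero s v = v
ValidFrom-F (suc h) s v = v

ValidFrom-F⁻¹ : ∀ h s → ValidFrom h (F ∷ s) → ValidFrom h s
ValidFrom-F⁻¹ zero s v = v
ValidFrom-F⁻¹ (suc h) s v = v

ValidFrom-downs : ∀ bs → ValidFrom (holes bs) (downs bs)
ValidFrom-downs [] = refl
ValidFrom-downs (true ∷ bs) = ValidFrom-F (holes bs) (downs bs) (ValidFrom-downs bs)
ValidFrom-downs (false ∷ bs) = ValidFrom-downs bs

Luk-upThenDowns : ∀ k bs → holes bs ≡ suc (suc k) → Luk (upThenDowns k bs)
Luk-upThenDowns k (true ∷ bs) h = Luk-upThenDowns k bs h
Luk-upThenDowns k (false ∷ bs) h = subst (λ m → ValidFrom m (downs bs)) (suc-injective h) (ValidFrom-downs bs)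

Luk-allFlat : ∀ bs → Luk (allFlat bs)
Luk-allFlat [] = refl
Luk-allFlat (b ∷ bs) = Luk-allFlat bs

Luk-realise : ∀ bs → Luk (realise bs)
Luk-realise bs with holes bs in h
... | zero = Luk-allFlat bs
... | suc zero = Luk-allFlat bs
... | suc (suc k) = Luk-upThenDowns k bs h

upCount-downs : ∀ bs → upCount (downs bs) ≡ 0
upCount-downs [] = refl
upCount-downs (true ∷ bs) = upCount-downs bs
upCount-downs (false ∷ bs) = upCount-downs bs

upCount-upThenDowns : ∀ k bs → upCount (upThenDowns k bs) ≤ 1
upCount-upThenDowns k [] = z≤n
upCount-upThenDowns k (true ∷ bs) = upCount-upThenDowns k bs
upCount-upThenDowns k (false ∷ bs) rewrite upCount-downs bs = s≤s z≤n

upCount-allFlat : ∀ bs → upCount (allFlat bs) ≤ 1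
upCount-allFlat [] = z≤n
upCount-allFlat (b ∷ bs) = upCount-allFlat bs

upCount-realise : ∀ bs → upCount (realise bs) ≤ 1
upCount-realise bs with holes bs
... | zero = upCount-allFlat bs
... | suc zero = upCount-allFlat bs
... | suc (suc k) = upCount-upThenDowns k bs

realiseWith-true∷ : ∀ m bs → realiseWith m (true ∷ bs) ≡ F ∷ realiseWith m bs
realiseWith-true∷ zero bs = refl
realiseWith-true∷ (suc zero) bs = refl
realiseWith-true∷ (suc (suc k)) bs = refl

downs-flats : ∀ h s → upCount s ≡ 0 → ValidFrom h s → holes (flats s) ≡ h × downs (flats s) ≡ s
downs-flats h [] _ v = sym v , refl
downs-flats (suc h) (D ∷ s) u v with downs-flats h s u v
... | hs , ds = cong suc hs , cong (D ∷_) ds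
downs-flats h (F ∷ s) u v with downs-flats h s u (ValidFrom-F⁻¹ h s v)
... | hs , ds = hs , cong (F ∷_) ds

realise-flats : ∀ p → Luk p → upCount p ≤ 1 → realise (flats p) ≡ p
realise-flats [] _ _ = refl
realise-flats (F ∷ p) v u =
  trans (realiseWith-true∷ (holes (flats p)) (flats p)) (cong (F ∷_) (realise-flats p v u))
realise-flats (U k ∷ s) v (s≤s u) with downs-flats (suc k) s (n≤0⇒n≡0 u) v
... | hs , ds rewrite hs = cong (U k ∷_) ds

holes-flats-ValidFrom : ∀ h q → ValidFrom h q → holes (flats q) ≡ 0 → h ≡ 0
holes-flats-ValidFrom h [] v _ = v
holes-flats-ValidFrom h (F ∷ q) v = holes-flats-ValidFrom h q (ValidFrom-F⁻¹ h q v)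

holes-flats-Luk≢1 : ∀ q → Luk q → holes (flats q) ≢ 1
holes-flats-Luk≢1 (F ∷ q) v = holes-flats-Luk≢1 q v
holes-flats-Luk≢1 (U k ∷ q) v h with holes-flats-ValidFrom (suc k) q v (suc-injective h)
... | ()

covers : List Step → List Bool
covers p = cover (pairs (flats p))

length-covers : ∀ p → length (covers p) ≡ length p
length-covers p = trans (length-coverFrom false (pairs (flats p))) (length-pairs-flats p)

holes-flats≤holes-covers : ∀ q → holes (flats q) ≤ holes (covers q)
holes-flats≤holes-covers q = holes-antitone (flats q) (covers q)
  (trans (length-map isF q) (sym (length-covers q))) (cover-pairs-⊆ (flats q))

holes-coverFrom-true : ∀ bs → holes bs ≡ 0 → holes (coverFrom true (pairs (true ∷ bs))) ≡ 0
holes-coverFrom-true [] _ = refl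
holes-coverFrom-true (true ∷ bs) h = holes-coverFrom-true bs h

-- A single uncovered position would be a single non-flat step, impossible in a Łukasiewicz path,
-- or a flat step with no flat neighbour in an otherwise all-flat path.
holes-covers≡1 : ∀ q → Luk q → holes (covers q) ≡ 1 → q ≡ F ∷ []
holes-covers≡1 q v h = lone q holes-flats≡0 h
  where
  holes-flats≡0 : holes (flats q) ≡ 0
  holes-flats≡0 = n<1⇒n≡0 (≤∧≢⇒< (subst (holes (flats q) ≤_) h (holes-flats≤holes-covers q))
                                   (holes-flats-Luk≢1 q v))
  lone : ∀ r → holes (flats r) ≡ 0 → holes (covers r) ≡ 1 → r ≡ F ∷ []
  lone [] _ ()
  lone (F ∷ []) _ _ = refl
  lone (F ∷ F ∷ r) hf h with trans (sym h) (holes-coverFrom-true (flats r) hf)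
  ... | ()

canonical : List Step → List Step
canonical q = realise (covers q)

covers-FFEquiv : ∀ p q → length p ≡ length q → FFEquiv p q → covers p ≡ covers q
covers-FFEquiv p q len equiv = cong cover (FFEquiv⇒pairs-≡ p q len equiv)

InFam⇒canonical-≡ : ∀ p → InFam p → canonical p ≡ p
InFam⇒canonical-≡ .[] (inj₁ refl) = refl
InFam⇒canonical-≡ .(F ∷ []) (inj₂ (inj₁ refl)) = refl
InFam⇒canonical-≡ p (inj₂ (inj₂ (v , u , every))) = begin
  realise (cover (pairs (flats p)))  ≡⟨ cong realise (cover-pairs-≡ (flats p) (to (EveryFInFF⇔PairCovered p) every)) ⟩
  realise (flats p)                  ≡⟨ realise-flats p v u ⟩
  p                                  ∎
  where open ≡-Reasoning

module _ (q : List Step) (h≢1 : holes (covers q) ≢ 1) where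

  flats-canonical : flats (canonical q) ≡ covers q
  flats-canonical = flats-realise (covers q) h≢1

  length-canonical : length (canonical q) ≡ length q
  length-canonical = trans (sym (length-map isF (canonical q)))
                           (trans (cong length flats-canonical) (length-covers q))

  canonical-FFEquiv : FFEquiv (canonical q) q
  canonical-FFEquiv = pairs-≡⇒FFEquiv (canonical q) q
    (trans (cong pairs flats-canonical) (pairs-cover-pairs (flats q)))

  InFam-canonical : InFam (canonical q)
  InFam-canonical = inj₂ (inj₂ (Luk-realise (covers q) , upCount-realise (covers q) , every))
    where
    every : EveryFInFF (canonical q)
    every = from (EveryFInFF⇔PairCovered (canonical q))
      (subst PairCovered (sym flats-canonical) (PairCovered-cover-pairs (flats q)))

FamPath : ℕ → Set
FamPath n = Σ (List Step) (λ p → length p ≡ n × InFam p)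

representative : ∀ {n} (q : LukN n) → Σ (FamPath n) (λ p → FFEquiv (proj₁ p) (proj₁ q))
representative (q , len , v) with holes (covers q) ≟ 1
... | yes h = (F ∷ [] , trans (cong length (sym q≡F)) len , inj₂ (inj₁ refl)) , FFEquiv-reflexive (sym q≡F)
  where q≡F = holes-covers≡1 q v h
... | no h≢1 = (canonical q , trans (length-canonical q h≢1) len , InFam-canonical q h≢1) , canonical-FFEquiv q h≢1

InFam⇒Luk : ∀ {p} → InFam p → Luk p
InFam⇒Luk (inj₁ refl) = refl
InFam⇒Luk (inj₂ (inj₁ refl)) = refl
InFam⇒Luk (inj₂ (inj₂ (v , _))) = v

lemma5 : (n : ℕ) → Bijection (FamSetoid n) (FFSetoid n)
lemma5 n = record
  { to = λ (p , len , fam) → p , len , InFam⇒Luk fam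
  ; cong = FFEquiv-reflexive
  ; bijective = (λ {x} {y} → injective {x} {y}) , surjective
  }
  where
  injective : ∀ {x y : FamPath n} → FFEquiv (proj₁ x) (proj₁ y) → proj₁ x ≡ proj₁ y
  injective {p , lp , fp} {q , lq , fq} equiv = begin
    p            ≡⟨ sym (InFam⇒canonical-≡ p fp) ⟩
    canonical p  ≡⟨ cong realise (covers-FFEquiv p q (trans lp (sym lq)) equiv) ⟩
    canonical q  ≡⟨ InFam⇒canonical-≡ q fq ⟩
    q            ∎
    where open ≡-Reasoning
  surjective : ∀ (y : LukN n) → Σ (FamPath n) (λ x → ∀ {z : FamPath n} → proj₁ z ≡ proj₁ x → FFEquiv (proj₁ z) (proj₁ y))
  surjective y = proj₁ (representative y) , λ z≡x → subst (λ r → FFEquiv r (proj₁ y)) (sym z≡x) (proj₂ (representative y))
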